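{- In the setting of the context, let $t$ be a node of the rooted tree decomposition with exactly two children $r$ and $s$, where $X_t=X_r=X_s$. Let $(S,c,\omega,\eta,\check c)\in\mathcal{D}_t$. Call a pair $(\eta_r,\eta_s)$ of valid partial neighborhood mappings for $c$ good if $$\check c_v\big(\eta(v)\boxplus^{v,c(v)}\textsc{ns}(v,c,(G_t\setminus S)[X_t])\boxplus^{v,c(v)}\eta_r(v)\boxplus^{v,c(v)}\eta_s(v)\big)=\textsc{True}\quad\text{for all } v\in X_t.$$ Let $W=\bigoplus_{v\in X_t}\omega(v)$. Then $$\lambda_t(S,c,\omega,\eta,\check c)=\min_{(\eta_r,\eta_s)\text{ good}}\Big\{W\oplus\lambda_r\big(X_r,c,\omega^e_{X_r},\eta^e_c,\check c^{\eta_r}\big)\oplus\lambda_s\big(X_s,c,\omega^e_{X_s},\eta^e_c,\check c^{\eta_s}\big)\Big\}.$$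
   Context: Notation: $\omega^e_X$ is the function on $X$ constantly equal to $e_\oplus$; $\eta^e_c$ (for $c$ valid in $X$) is the function on $X$ with $\eta^e_c(v)=e_{v,c(v)}$; for a valid partial neighborhood mapping $\eta'$ for $c$, $\check c^{\eta'}$ is the function on $X$ with $\check c^{\eta'}_v = eq_{\eta'(v)}$. For a graph $H$ and $Y\subseteq V(H)$, $H[Y]$ is the induced subgraph. Setting. $G$ is a finite simple graph; for each $v \in V(G)$, $L_v$ is a nonempty list of colors. $(\textsc{Weights},\preceq)$ is a totally ordered set with maximum element $\textsc{Error}$; $\min$ is the minimum with respect to $\preceq$ (the minimum over an empty set is $\textsc{Error}$); $\oplus$ is a commutative, associative operation on $\textsc{Weights}$ with neutral element $e_\oplus$ and absorbing element $\textsc{Error}$, such that $s_1\preceq s_2 \Rightarrow s_1\oplus s_3 \preceq s_2\oplus s_3$. For each $v$ and $i\in L_v$ a weight $\textsc{w}_{v,i}\in\textsc{Weights}\setminus\{\textsc{Error}\}$ is given, and $check(v,c)\in\{\textsc{True},\textsc{False}\}$ is given for every $v$ and every color assignment $c$ on $N_G[v]$ with $c(u)\in L_u$. For $X\subseteq V(G)$, a color assignment valid in $X$ is a function $c$ with domain $X$ and $c(u)\in L_u$ for all $u\in X$. Partial neighborhood system: for every $v$ and $i\in L_v$, a set $N_{v,i}$ with a commutative associative operation $\boxplus^{v,i}$ having neutral element $e_{v,i}$; a function $newN_{v,i}$ assigning to each $u\in N_G(v)$ and $j\in L_u$ an element of $N_{v,i}$; and a function $check_{v,i}\colon N_{v,i}\to\{\textsc{True},\textsc{False}\}$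 such that $check_{v,c(v)}\big(\boxplus^{v,c(v)}_{u\in N_G(v)} newN_{v,c(v)}(u,c(u))\big) = check(v,c)$ for every $v$ and every $c$ valid in $N_G[v]$. For $n\in N_{v,i}$, $eq_n(n') = (n=n')$. If $c$ is valid in $X$, a valid partial neighborhood mapping for $c$ is a function $\eta$ on $X$ with $\eta(u)\in N_{u,c(u)}$. For a subgraph $H$ of $G$ and $c$ valid in $V(H)$, $\textsc{ns}(v,c,H) = \boxplus^{v,c(v)}_{u\in N_H(v)} newN_{v,c(v)}(u,c(u))$ (equal to $e_{v,c(v)}$ if $N_H(v)=\emptyset$). For a graph $H$ and $S\subseteq V(H)$, $H\setminus S$ denotes the graph with vertex set $V(H)$ and edge set $E(H)\setminus\{uv: u,v\in S\}$. Colorings. Let $X\subseteq V(G)$, $G'$ a subgraph of $G$ with $X\subseteq V(G')$ and $N_G[V(G')\setminus X]\subseteq V(G')$, $c$ valid in $X$, $\eta$ a valid partial neighborhood mapping for $c$, and $\check c$ a function assigning to each $v\in X$ a function $\check c_v \in \{check_{v,c(v)}\}\cup\{eq_n : n\in N_{v,c(v)}\}$. A function $f$ is an $(X,c,\eta,\check c)$-coloring in $G'$ if $f$ is a color assignment valid in $V(G')$, $f(v)=c(v)$ for $v\in X$, $\check c_v(\eta(v)\boxplus^{v,f(v)}\textsc{ns}(v,f,G'))=\textsc{True}$ for all $v\in X$, and $check(u,f|_{N_G[u]})=\textsc{True}$ for all $u\in V(G')\setminus X$. For $\omega\colon X\to\textsc{Weights}$, $\textsc{w}_\omega(f) = \big(\bigoplus_{v\in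 X}\omega(v)\big)\oplus\big(\bigoplus_{v\in V(G')\setminus X}\textsc{w}_{v,f(v)}\big)$. Tree decomposition. $(T,\{X_t\}_{t\in V(T)})$ is a tree decomposition of $G$ with $T$ rooted; $G_t$ is the subgraph of $G$ induced by the union of the bags $X_{t'}$ over the nodes $t'$ of the subtree of $T$ rooted at $t$. $\mathcal{D}_t$ is the set of tuples $(S,c,\omega,\eta,\check c)$ with $S\subseteq X_t$, $c$ valid in $X_t$, $\omega\colon X_t\to\textsc{Weights}$ with $\omega(v)\in\{e_\oplus,\textsc{w}_{v,c(v)}\}$, $\eta$ a valid partial neighborhood mapping for $c$, and $\check c_v\in\{check_{v,c(v)}\}\cup\{eq_n: n\in N_{v,c(v)}\}$ for $v\in X_t$. Define $\lambda_t(S,c,\omega,\eta,\check c) = \min\{\textsc{w}_\omega(f) : f \text{ is an } (X_t,c,\eta,\check c)\text{ -coloring in } G_t\setminus S\}$. -}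

module Defs where

open import Data.Nat using (ℕ; zero; suc)
open import Data.Fin using (Fin; _≟_)
open import Data.Bool using (Bool; true; false; _∧_; not; if_then_else_)
open import Data.List using (List; []; _∷_; foldr; allFin; upTo)
open import Data.Bool.ListAction using (any)
open import Data.List.Membership.Propositional using (_∈_)
open import Data.Product using (Σ; ∃; _×_; _,_)
open import Data.Sum using (_⊎_)
open import Relation.Nullary using (¬_)
open import Relation.Nullary.Decidable using (⌊_⌋)
open import Relation.Binary.PropositionalEquality using (_≡_)
open import Relation.Binary.Structures using (IsTotalOrder)

bigop : ∀ {n} {A : Set} → (A → A → A) → A → (Fin n → Bool) → (Fin n → A) → A
bigop {n} op z p g = foldr (λ u acc → if p u then op (g u) acc else acc) z (allFin n)

iter : ∀ {A : Set} → (A → A) → ℕ → A → A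
iter f zero    x = x
iter f (suc k) x = f (iter f k x)

record WeightStructure : Set₁ where
  field
    Wt         : Set
    _≼_        : Wt → Wt → Set
    isTotal    : IsTotalOrder _≡_ _≼_
    Error      : Wt
    Error-max  : ∀ x → x ≼ Error
    _⊕_        : Wt → Wt → Wt
    e⊕         : Wt
    ⊕-assoc    : ∀ x y z → (x ⊕ y) ⊕ z ≡ x ⊕ (y ⊕ z)
    ⊕-comm     : ∀ x y → x ⊕ y ≡ y ⊕ x
    ⊕-identity : ∀ x → e⊕ ⊕ x ≡ x
    ⊕-absorb   : ∀ x → Error ⊕ x ≡ Error
    ⊕-mono     : ∀ x y z → x ≼ y → (x ⊕ z) ≼ (y ⊕ z)

-- Color assignments are total functions Fin n → Color; "valid in X" is
-- the condition c u ∈ L u for u ∈ X (values outside X are irrelevant).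

record Setting (n : ℕ) : Set₂ where
  field
    WS      : WeightStructure
  open WeightStructure WS
  field
    adj        : Fin n → Fin n → Bool
    adj-sym    : ∀ u v → adj u v ≡ adj v u
    adj-irrefl : ∀ v → adj v v ≡ false
    Color      : Set
    L          : Fin n → List Color
    L-nonempty : ∀ v → ¬ (L v ≡ [])
    w          : Fin n → Color → Wt
    w-ok       : ∀ v i → i ∈ L v → ¬ (w v i ≡ Error)
    check      : Fin n → (Fin n → Color) → Bool
    N          : Fin n → Color → Set
    plus       : (v : Fin n) (i : Color) → N v i → N v i → N v i
    eN         : (v : Fin n) (i : Color) → N v i
    plus-assoc : ∀ v i x y z → plus v i (plus v i x y) z ≡ plus v i x (plus v i y z)
    plus-comm  : ∀ v i x y → plus v i x y ≡ plus v i y x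
    plus-id    : ∀ v i x → plus v i (eN v i) x ≡ x
    newN       : (v : Fin n) (i : Color) → Fin n → Color → N v i
    checkN     : (v : Fin n) (i : Color) → N v i → Bool
    checkN-spec : ∀ v (c : Fin n → Color) →
                  (∀ u → (u ≡ v ⊎ adj v u ≡ true) → c u ∈ L u) →
                  checkN v (c v) (bigop (plus v (c v)) (eN v (c v)) (adj v)
                                        (λ u → newN v (c v) u (c u)))
                    ≡ check v c

TAdj : ∀ {m} → (Fin m → Fin m) → Fin m → Fin m → Set
TAdj parent a b = parent a ≡ b ⊎ parent b ≡ a

data TPath {m} (parent : Fin m → Fin m) (P : Fin m → Set) : Fin m → Fin m → Set where
  here : ∀ {a} → TPath parent P a a
  step : ∀ {a a' b} → TAdj parent a a' → P a' → TPath parent P a' b → TPath parent P a b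

module _ {n : ℕ} (σ : Setting n) where
  open Setting σ

  record TreeDec : Set where
    field
      m        : ℕ
      root     : Fin m
      parent   : Fin m → Fin m
      parent-root : parent root ≡ root
      reaches  : ∀ t → ∃ λ k → iter parent k t ≡ root
      bag      : Fin m → Fin n → Bool

    field
      cover-v  : ∀ v → ∃ λ t → bag t v ≡ true
      cover-e  : ∀ u v → adj u v ≡ true → ∃ λ t → (bag t u ≡ true × bag t v ≡ true)
      connected : ∀ v a b → bag a v ≡ true → bag b v ≡ true →
                  TPath parent (λ t → bag t v ≡ true) a b

module Ctx {n : ℕ} (σ : Setting n) (τ : TreeDec σ) where
  open Setting σ public
  open WeightStructure WS public
  open TreeDec τ public

  VSet : Set
  VSet = Fin n → Bool

  record Subgraph : Set where
    constructor sg
    field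
      vert : VSet
      edge : Fin n → Fin n → Bool
  open Subgraph public

  inSubtree : Fin m → Fin m → Bool
  inSubtree t t' = any (λ k → ⌊ iter parent k t' ≟ t ⌋) (upTo (suc m))

  Gt : Fin m → Subgraph
  Gt t = sg Vt (λ u v → adj u v ∧ Vt u ∧ Vt v)
    where
    Vt : VSet
    Vt u = any (λ t' → inSubtree t t' ∧ bag t' u) (allFin m)

  _∖ₑ_ : Subgraph → VSet → Subgraph
  H ∖ₑ S = sg (vert H) (λ u v → edge H u v ∧ not (S u ∧ S v))

  _[_] : Subgraph → VSet → Subgraph
  H [ Y ] = sg (λ u → vert H u ∧ Y u) (λ u v → edge H u v ∧ Y u ∧ Y v)

  -- ns(v, f, H), computed in N_{v,i} with i = f(v)
  ns : (v : Fin n) (i : Color) → (Fin n → Color) → Subgraph → N v i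
  ns v i f H = bigop (plus v i) (eN v i) (edge H v) (λ u → newN v i u (f u))

  -- the allowed functions ĉ_v : either check_{v,i} or eq_x for x ∈ N_{v,i}
  data CheckSpec (v : Fin n) (i : Color) : Set where
    useCheck : CheckSpec v i
    useEq    : N v i → CheckSpec v i

  Holds : ∀ {v i} → CheckSpec v i → N v i → Set
  Holds {v} {i} useCheck  x = checkN v i x ≡ true
  Holds         (useEq y) x = y ≡ x

  ValidIn : VSet → (Fin n → Color) → Set
  ValidIn X c = ∀ u → X u ≡ true → c u ∈ L u

  IsColoring : (X : VSet) (G' : Subgraph) (c : Fin n → Color)
               (η : (v : Fin n) → N v (c v)) (ĉ : (v : Fin n) → CheckSpec v (c v))
               (f : Fin n → Color) → Set
  IsColoring X G' c η ĉ f =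
      ValidIn (vert G') f
    × (∀ v → X v ≡ true → f v ≡ c v)
    × (∀ v → X v ≡ true → Holds (ĉ v) (plus v (c v) (η v) (ns v (c v) f G')))
    × (∀ u → vert G' u ≡ true → X u ≡ false → check u f ≡ true)

  wsum : VSet → (Fin n → Wt) → Wt
  wsum = bigop _⊕_ e⊕

  wω : (X : VSet) (G' : Subgraph) (ω : Fin n → Wt) (f : Fin n → Color) → Wt
  wω X G' ω f = wsum X ω ⊕ wsum (λ u → vert G' u ∧ not (X u)) (λ u → w u (f u))

  -- s is the minimum (w.r.t. ≼) of the set P, with min ∅ = Error
  IsMin : Wt → (Wt → Set) → Set
  IsMin s P = (∀ x → P x → s ≼ x) × (s ≡ Error ⊎ P s)

  InD : Fin m → VSet → (c : Fin n → Color) → (Fin n → Wt) → Set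
  InD t S c ω = (∀ u → S u ≡ true → bag t u ≡ true)
              × ValidIn (bag t) c
              × (∀ v → bag t v ≡ true → (ω v ≡ e⊕ ⊎ ω v ≡ w v (c v)))

  LamSet : Fin m → VSet → (c : Fin n → Color) → (Fin n → Wt) →
           ((v : Fin n) → N v (c v)) → ((v : Fin n) → CheckSpec v (c v)) → Wt → Set
  LamSet t S c ω η ĉ x =
    ∃ λ f → IsColoring (bag t) (Gt t ∖ₑ S) c η ĉ f × wω (bag t) (Gt t ∖ₑ S) ω f ≡ x

  LamType : Set
  LamType = (t : Fin m) (S : VSet) (c : Fin n → Color) (ω : Fin n → Wt)
            (η : (v : Fin n) → N v (c v)) (ĉ : (v : Fin n) → CheckSpec v (c v)) → Wt

  IsLambda : LamType → Set
  IsLambda lam = ∀ t S c ω η ĉ → InD t S c ω → IsMin (lam t S c ω η ĉ) (LamSet t S c ω η ĉ)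

  ωe : Fin n → Wt
  ωe _ = e⊕

  ηe : (c : Fin n → Color) → (v : Fin n) → N v (c v)
  ηe c v = eN v (c v)

  ĉeq : (c : Fin n → Color) → ((v : Fin n) → N v (c v)) → (v : Fin n) → CheckSpec v (c v)
  ĉeq c η' v = useEq (η' v)

  IsChild : Fin m → Fin m → Set
  IsChild r t = parent r ≡ t × ¬ (r ≡ t)

  Good : (t : Fin m) (S : VSet) (c : Fin n → Color) (η : (v : Fin n) → N v (c v))
         (ĉ : (v : Fin n) → CheckSpec v (c v)) (ηr ηs : (v : Fin n) → N v (c v)) → Set
  Good t S c η ĉ ηr ηs = ∀ v → bag t v ≡ true →
    Holds (ĉ v) (plus v (c v) (plus v (c v) (plus v (c v) (η v)
                   (ns v (c v) c ((Gt t ∖ₑ S) [ bag t ]))) (ηr v)) (ηs v))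

  JoinSet : LamType → (t r s : Fin m) (S : VSet) (c : Fin n → Color) (ω : Fin n → Wt)
            (η : (v : Fin n) → N v (c v)) (ĉ : (v : Fin n) → CheckSpec v (c v)) → Wt → Set
  JoinSet lam t r s S c ω η ĉ x =
    Σ ((v : Fin n) → N v (c v)) λ ηr → Σ ((v : Fin n) → N v (c v)) λ ηs →
      Good t S c η ĉ ηr ηs ×
      (x ≡ (wsum (bag t) ω ⊕ lam r (bag r) c ωe (ηe c) (ĉeq c ηr))
              ⊕ lam s (bag s) c ωe (ηe c) (ĉeq c ηs))

-- Since X_r = X_s = X_t, every vertex of G_t lies in X_t or in exactly one of G_r, G_s, and a
-- vertex of G_r outside X_t has its whole neighbourhood in G_r (the bags containing a vertex form
-- a subtree).  Hence the neighbourhood of a bag vertex in G_t ∖ S splits into its part inside X_t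
-- and its parts in G_r ∖ X_r and G_s ∖ X_s, and the weight of a coloring splits likewise.  So
-- colorings of the children whose neighbourhood sums on X_t are prescribed by a good pair
-- (η_r, η_s) glue to a coloring of G_t ∖ S of the combined weight, and conversely an optimal
-- coloring of G_t ∖ S restricts to the children with a good pair read off from it; these two
-- facts give the lower bound and its attainment.
module Submission where

open import Algebra.Core using (Op₂)
open import Algebra.Definitions using (Associative; Commutative; LeftIdentity)
open import Data.Bool using (Bool; true; false; _∧_; not; if_then_else_)
open import Data.Bool.ListAction using (any)
open import Data.Bool.Properties using (T-≡; T-∧; ∧-comm; ∧-zeroʳ)
open import Data.Empty using (⊥; ⊥-elim)
open import Data.Fin using (Fin; toℕ; _≟_)
import Data.Fin.Properties as Fin
open import Data.List using (List; []; _∷_; foldr; allFin; upTo)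
open import Data.List.Membership.Propositional using (_∈_; lose)
open import Data.List.Membership.Propositional.Properties using (∈-allFin; ∈-upTo⁺)
open import Data.List.Relation.Unary.Any using (satisfied)
open import Data.List.Relation.Unary.Any.Properties using (any⁺; any⁻)
open import Data.Nat using (ℕ; zero; suc; _+_; _*_; _∸_; _≤_; _<_; s≤s; s≤s⁻¹; _≤?_)
open import Data.Nat.Induction using (<-rec)
open import Data.Nat.Properties
  using (≤-trans; ≤-reflexive; ≤-total; <⇒≤; <-≤-trans; ≰⇒>; n<1+n; +-monoʳ-<; m∸n+n≡m;
         *-suc; +-comm)
open import Data.Product using (∃-syntax; _×_; _,_; proj₁; proj₂)
open import Data.Sum using (_⊎_; inj₁; inj₂)
open import Function using (_∘_)
open import Function.Bundles using (Equivalence)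
open import Relation.Binary.PropositionalEquality hiding ([_])
open import Relation.Binary.Structures using (IsTotalOrder)
open import Relation.Nullary using (yes; no; ¬_; contradiction)
open import Relation.Nullary.Decidable using (toWitness; fromWitness)

open import Defs

module _ {A : Set} (f : A → A) where

  iter-+ : ∀ a b x → iter f (a + b) x ≡ iter f a (iter f b x)
  iter-+ zero    b x = refl
  iter-+ (suc a) b x = cong f (iter-+ a b x)

  iter-sucʳ : ∀ k x → iter f (suc k) x ≡ iter f k (f x)
  iter-sucʳ zero    x = refl
  iter-sucʳ (suc k) x = cong f (iter-sucʳ k x)

  iter-fixed : ∀ {x} → f x ≡ x → ∀ k → iter f k x ≡ x
  iter-fixed fx≡x zero    = refl
  iter-fixed fx≡x (suc k) = trans (cong f (iter-fixed fx≡x k)) fx≡x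

  iter-periodic : ∀ {x} k → iter f (suc k) x ≡ x → ∀ j → iter f (j * suc k) x ≡ x
  iter-periodic k cycle zero        = refl
  iter-periodic {x} k cycle (suc j) =
    trans (iter-+ (suc k) (j * suc k) x) (trans (cong (iter f (suc k)) (iter-periodic k cycle j)) cycle)

  iter-∸ : ∀ {k₁ k₂} x → k₁ ≤ k₂ → iter f k₂ x ≡ iter f (k₂ ∸ k₁) (iter f k₁ x)
  iter-∸ {k₁} {k₂} x k₁≤k₂ =
    trans (cong (λ k → iter f k x) (sym (m∸n+n≡m k₁≤k₂))) (iter-+ (k₂ ∸ k₁) k₁ x)

-- Among the first m + 1 iterates two coincide (pigeonhole), and the loop between them can be cut out.
iter-shorten : ∀ {m} (f : Fin m → Fin m) {x y} k → iter f k x ≡ y → ∃[ k′ ] k′ ≤ m × iter f k′ x ≡ y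
iter-shorten {m} f {x} {y} = <-rec Shortenable shorten
  where
  Shortenable : ℕ → Set
  Shortenable k = iter f k x ≡ y → ∃[ k′ ] k′ ≤ m × iter f k′ x ≡ y

  shorten : ∀ k → (∀ {j} → j < k → Shortenable j) → Shortenable k
  shorten k rec fᵏx≡y with k ≤? m
  ... | yes k≤m = k , k≤m , fᵏx≡y
  ... | no  k≰m with Fin.pigeonhole (n<1+n m) (λ i → iter f (toℕ i) x)
  ... | i , j , i<j , fⁱx≡fʲx = rec shorter (trans loop-removed fᵏx≡y)
    where
    j≤k : toℕ j ≤ k
    j≤k = ≤-trans (s≤s⁻¹ (Fin.toℕ<n j)) (<⇒≤ (≰⇒> k≰m))
    shorter : (k ∸ toℕ j) + toℕ i < k
    shorter = <-≤-trans (+-monoʳ-< (k ∸ toℕ j) i<j) (≤-reflexive (m∸n+n≡m j≤k))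
    loop-removed : iter f ((k ∸ toℕ j) + toℕ i) x ≡ iter f k x
    loop-removed = begin
      iter f ((k ∸ toℕ j) + toℕ i) x        ≡⟨ iter-+ f (k ∸ toℕ j) (toℕ i) x ⟩
      iter f (k ∸ toℕ j) (iter f (toℕ i) x) ≡⟨ cong (iter f (k ∸ toℕ j)) fⁱx≡fʲx ⟩
      iter f (k ∸ toℕ j) (iter f (toℕ j) x) ≡⟨ iter-∸ f x j≤k ⟨
      iter f k x                            ∎
      where open ≡-Reasoning

∧-trueˡ : ∀ a {b} → a ∧ b ≡ true → a ≡ true
∧-trueˡ true _ = refl

module FilteredFold {A I : Set} (_∙_ : Op₂ A) (ε : A) (∙-assoc : Associative _≡_ _∙_)
                    (∙-comm : Commutative _≡_ _∙_) (∙-identityˡ : LeftIdentity _≡_ ε _∙_) where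

  -- bigop _∙_ ε p g is foldWhere (allFin n) p g by definition.
  foldWhere : List I → (I → Bool) → (I → A) → A
  foldWhere xs p g = foldr (λ u acc → if p u then g u ∙ acc else acc) ε xs

  foldWhere-cong : ∀ xs {p q g h} → (∀ u → p u ≡ q u) → (∀ u → q u ≡ true → g u ≡ h u) →
                   foldWhere xs p g ≡ foldWhere xs q h
  foldWhere-cong []       p≗q g≗h = refl
  foldWhere-cong (x ∷ xs) {q = q} p≗q g≗h rewrite p≗q x with q x in qx
  ... | true  = cong₂ _∙_ (g≗h x qx) (foldWhere-cong xs p≗q g≗h)
  ... | false = foldWhere-cong xs p≗q g≗h

  foldWhere-ε : ∀ xs (p : I → Bool) → foldWhere xs p (λ _ → ε) ≡ ε
  foldWhere-ε []       p = refl
  foldWhere-ε (x ∷ xs) p with p x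
  ... | true  = trans (∙-identityˡ _) (foldWhere-ε xs p)
  ... | false = foldWhere-ε xs p

  foldWhere-split : ∀ xs (p q : I → Bool) g → foldWhere xs p g ≡
                    foldWhere xs (λ u → q u ∧ p u) g ∙ foldWhere xs (λ u → not (q u) ∧ p u) g
  foldWhere-split []       p q g = sym (∙-identityˡ ε)
  foldWhere-split (x ∷ xs) p q g with q x | p x
  ... | true  | false = foldWhere-split xs p q g
  ... | false | false = foldWhere-split xs p q g
  ... | true  | true  = trans (cong (g x ∙_) (foldWhere-split xs p q g)) (sym (∙-assoc _ _ _))
  ... | false | true  = trans (cong (g x ∙_) (foldWhere-split xs p q g)) (interchange _ _ _)
    where
    interchange : ∀ a b c → a ∙ (b ∙ c) ≡ b ∙ (a ∙ c)
    interchange a b c = begin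
      a ∙ (b ∙ c) ≡⟨ ∙-assoc a b c ⟨
      (a ∙ b) ∙ c ≡⟨ cong (_∙ c) (∙-comm a b) ⟩
      (b ∙ a) ∙ c ≡⟨ ∙-assoc b a c ⟩
      b ∙ (a ∙ c) ∎
      where open ≡-Reasoning

-- The possible memberships of a vertex in (X_t, V(G_r), V(G_s), V(G_t)) when r and s are the
-- only children of t and X_r = X_s = X_t.
data Position : Bool → Bool → Bool → Bool → Set where
  inBag   : Position true  true  true  true
  onlyR   : Position false true  false true
  onlyS   : Position false false true  true
  outside : Position false false false false

module _ {x vr vs vt : Bool} where

  Position-vertexʳ : Position x vr vs vt → vr ∧ (vt ∧ not x) ≡ vr ∧ not x
  Position-vertexʳ inBag   = refl
  Position-vertexʳ onlyR   = refl
  Position-vertexʳ onlyS   = refl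
  Position-vertexʳ outside = refl

  Position-vertexˢ : Position x vr vs vt → not vr ∧ (vt ∧ not x) ≡ vs ∧ not x
  Position-vertexˢ inBag   = refl
  Position-vertexˢ onlyR   = refl
  Position-vertexˢ onlyS   = refl
  Position-vertexˢ outside = refl

  -- a is the adjacency of u to a bag vertex v, and κ is the condition not (S v ∧ S u) of
  -- G_t ∖ S, which is automatic off the bag since S ⊆ X_t.
  Position-edgeʳ : Position x vr vs vt → ∀ a κ → (x ≡ false → κ ≡ true) →
                   vr ∧ (not x ∧ ((a ∧ vt) ∧ κ)) ≡ (a ∧ vr) ∧ not x
  Position-edgeʳ inBag   false _ _         = refl
  Position-edgeʳ inBag   true  _ _         = refl
  Position-edgeʳ onlyR   false _ _         = refl
  Position-edgeʳ onlyR   true  _ κ-outside = κ-outside refl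
  Position-edgeʳ onlyS   false _ _         = refl
  Position-edgeʳ onlyS   true  _ _         = refl
  Position-edgeʳ outside false _ _         = refl
  Position-edgeʳ outside true  _ _         = refl

  Position-edgeˢ : Position x vr vs vt → ∀ a κ → (x ≡ false → κ ≡ true) →
                   not vr ∧ (not x ∧ ((a ∧ vt) ∧ κ)) ≡ (a ∧ vs) ∧ not x
  Position-edgeˢ inBag   false _ _         = refl
  Position-edgeˢ inBag   true  _ _         = refl
  Position-edgeˢ onlyR   false _ _         = refl
  Position-edgeˢ onlyR   true  _ _         = refl
  Position-edgeˢ onlyS   false _ _         = refl
  Position-edgeˢ onlyS   true  _ κ-outside = κ-outside refl
  Position-edgeˢ outside false _ _         = refl
  Position-edgeˢ outside true  _ _         = refl

module WeightProperties (WS : WeightStructure) where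
  open WeightStructure WS
  open IsTotalOrder isTotal using () renaming (trans to ≼-trans)

  ⊕-absorbʳ : ∀ x → x ⊕ Error ≡ Error
  ⊕-absorbʳ x = trans (⊕-comm x Error) (⊕-absorb x)

  ⊕-monoʳ : ∀ x y z → x ≼ y → (z ⊕ x) ≼ (z ⊕ y)
  ⊕-monoʳ x y z x≼y = subst₂ _≼_ (⊕-comm x z) (⊕-comm y z) (⊕-mono x y z x≼y)

  ⊕-mono₂ : ∀ w {a a′ b b′} → a ≼ a′ → b ≼ b′ → ((w ⊕ a) ⊕ b) ≼ ((w ⊕ a′) ⊕ b′)
  ⊕-mono₂ w {a} {a′} {b} {b′} a≼a′ b≼b′ =
    ≼-trans (⊕-monoʳ b b′ (w ⊕ a) b≼b′) (⊕-mono (w ⊕ a) (w ⊕ a′) b′ (⊕-monoʳ a a′ w a≼a′))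

module _ {n : ℕ} (σ : Setting n) (τ : TreeDec σ) where
  open Ctx σ τ
  open Equivalence using (to; from)
  open WeightProperties WS
  open IsTotalOrder isTotal using (antisym)

  module ⊞ (v : Fin n) (i : Color) =
    FilteredFold {I = Fin n} (plus v i) (eN v i) (plus-assoc v i) (plus-comm v i) (plus-id v i)
  module ⊕ = FilteredFold {I = Fin n} _⊕_ e⊕ ⊕-assoc ⊕-comm ⊕-identity

  InSubtree : Fin m → Fin m → Set
  InSubtree t t′ = ∃[ k ] iter parent k t′ ≡ t

  inSubtree⁻ : ∀ {t t′} → inSubtree t t′ ≡ true → InSubtree t t′
  inSubtree⁻ e with satisfied (any⁻ _ (upTo (suc m)) (from T-≡ e))
  ... | k , fᵏt′≡t = k , toWitness fᵏt′≡t

  inSubtree⁺ : ∀ {t t′} → InSubtree t t′ → inSubtree t t′ ≡ true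
  inSubtree⁺ (k , fᵏt′≡t) with iter-shorten parent k fᵏt′≡t
  ... | k′ , k′≤m , fᵏ′t′≡t = to T-≡ (any⁺ _ (lose (∈-upTo⁺ (s≤s k′≤m)) (fromWitness fᵏ′t′≡t)))

  V : Fin m → VSet
  V t = vert (Gt t)

  V⁻ : ∀ {t u} → V t u ≡ true → ∃[ t′ ] InSubtree t t′ × bag t′ u ≡ true
  V⁻ e with satisfied (any⁻ _ (allFin m) (from T-≡ e))
  ... | t′ , h with to T-∧ h
  ... | sub , u∈t′ = t′ , inSubtree⁻ (to T-≡ sub) , to T-≡ u∈t′

  V⁺ : ∀ {t t′ u} → InSubtree t t′ → bag t′ u ≡ true → V t u ≡ true
  V⁺ {t′ = t′} sub u∈t′ =
    to T-≡ (any⁺ _ (lose (∈-allFin t′) (from T-∧ (from T-≡ (inSubtree⁺ sub) , from T-≡ u∈t′))))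

  iter-root : ∀ k → iter parent k root ≡ root
  iter-root = iter-fixed parent parent-root

  periodic⇒root : ∀ {x} k → iter parent (suc k) x ≡ x → x ≡ root
  periodic⇒root {x} k cycle with reaches x
  ... | K , fᴷx≡root = begin
    x                                     ≡⟨ iter-periodic parent k cycle K ⟨
    iter parent (K * suc k) x             ≡⟨ cong (λ j → iter parent j x) K[1+k]≡Kk+K ⟩
    iter parent (K * k + K) x             ≡⟨ iter-+ parent (K * k) K x ⟩
    iter parent (K * k) (iter parent K x) ≡⟨ cong (iter parent (K * k)) fᴷx≡root ⟩
    iter parent (K * k) root              ≡⟨ iter-root (K * k) ⟩
    root                                  ∎
    where
    open ≡-Reasoning
    K[1+k]≡Kk+K : K * suc k ≡ K * k + K
    K[1+k]≡Kk+K = trans (*-suc K k) (+-comm K (K * k))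

  InSubtree-child : ∀ {r t x} → parent r ≡ t → InSubtree r x → InSubtree t x
  InSubtree-child pr (k , fᵏx≡r) = suc k , trans (cong parent fᵏx≡r) pr

  InSubtree-children : ∀ {t x} → InSubtree t x → x ≡ t ⊎ ∃[ r ] IsChild r t × InSubtree r x
  InSubtree-children {t} {x} (k , fᵏx≡t) = descend k fᵏx≡t
    where
    descend : ∀ k → iter parent k x ≡ t → x ≡ t ⊎ ∃[ r ] IsChild r t × InSubtree r x
    descend zero    x≡t = inj₁ x≡t
    descend (suc k) e with iter parent k x ≟ t
    ... | yes y≡t = descend k y≡t
    ... | no  y≢t = inj₂ (iter parent k x , (e , y≢t) , k , refl)

  sibling-not-ancestor : ∀ {t r s} → IsChild r t → IsChild s t → ¬ r ≡ s →
                         ∀ d → ¬ iter parent d r ≡ s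
  sibling-not-ancestor _ _ r≢s zero = r≢s
  sibling-not-ancestor {t} {r} {s} (pr , _) (ps , s≢t) _ (suc d) fᵈ⁺¹r≡s =
    s≢t (trans s≡root (sym t≡root))
    where
    fᵈt≡s : iter parent d t ≡ s
    fᵈt≡s = trans (cong (iter parent d) (sym pr)) (trans (sym (iter-sucʳ parent d r)) fᵈ⁺¹r≡s)
    t≡root : t ≡ root
    t≡root = periodic⇒root d (trans (cong parent fᵈt≡s) ps)
    s≡root : s ≡ root
    s≡root = trans (sym fᵈt≡s) (trans (cong (iter parent d) t≡root) (iter-root d))

  siblings-disjoint : ∀ {t r s x} → IsChild r t → IsChild s t → ¬ r ≡ s →
                      InSubtree r x → InSubtree s x → ⊥
  siblings-disjoint {x = x} cr cs r≢s (k₁ , fᵏ¹x≡r) (k₂ , fᵏ²x≡s) with ≤-total k₁ k₂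
  ... | inj₁ k₁≤k₂ = sibling-not-ancestor cr cs r≢s (k₂ ∸ k₁)
        (trans (cong (iter parent (k₂ ∸ k₁)) (sym fᵏ¹x≡r)) (trans (sym (iter-∸ parent x k₁≤k₂)) fᵏ²x≡s))
  ... | inj₂ k₂≤k₁ = sibling-not-ancestor cs cr (r≢s ∘ sym) (k₁ ∸ k₂)
        (trans (cong (iter parent (k₁ ∸ k₂)) (sym fᵏ²x≡s)) (trans (sym (iter-∸ parent x k₂≤k₁)) fᵏ¹x≡r))

  TPath-leaving-subtree : ∀ {P : Fin m → Set} {r t a b} → parent r ≡ t → InSubtree r a →
                          TPath parent P a b → InSubtree r b ⊎ P t
  TPath-leaving-subtree pr sub here = inj₁ sub
  TPath-leaving-subtree {P} pr (zero , a≡r) (step (inj₁ pa≡a′) Pa′ _) =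
    inj₂ (subst P (trans (sym pa≡a′) (trans (cong parent a≡r) pr)) Pa′)
  TPath-leaving-subtree {r = r} {a = a} pr (suc k , fᵏ⁺¹a≡r) (step {a' = a′} (inj₁ pa≡a′) _ path) =
    TPath-leaving-subtree pr (k , fᵏa′≡r) path
    where
    fᵏa′≡r : iter parent k a′ ≡ r
    fᵏa′≡r = trans (cong (iter parent k) (sym pa≡a′)) (trans (sym (iter-sucʳ parent k a)) fᵏ⁺¹a≡r)
  TPath-leaving-subtree {r = r} pr (k , fᵏa≡r) (step {a' = a′} (inj₂ pa′≡a) _ path) =
    TPath-leaving-subtree pr (suc k , fᵏ⁺¹a′≡r) path
    where
    fᵏ⁺¹a′≡r : iter parent (suc k) a′ ≡ r
    fᵏ⁺¹a′≡r = trans (iter-sucʳ parent k a′) (trans (cong (iter parent k) pa′≡a) fᵏa≡r)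

  bag⊆V : ∀ {t u} → bag t u ≡ true → V t u ≡ true
  bag⊆V = V⁺ (0 , refl)

  V-child : ∀ {r t u} → parent r ≡ t → V r u ≡ true → V t u ≡ true
  V-child pr u∈Vr with V⁻ u∈Vr
  ... | _ , sub , u∈bag = V⁺ (InSubtree-child pr sub) u∈bag

  V-children : ∀ {t r s u} → (∀ t′ → IsChild t′ t → t′ ≡ r ⊎ t′ ≡ s) →
               V t u ≡ true → bag t u ≡ true ⊎ V r u ≡ true ⊎ V s u ≡ true
  V-children children u∈Vt with V⁻ u∈Vt
  ... | _ , sub , u∈bag with InSubtree-children sub
  ... | inj₁ refl = inj₁ u∈bag
  ... | inj₂ (c , c-child , sub′) with children c c-child
  ... | inj₁ refl = inj₂ (inj₁ (V⁺ sub′ u∈bag))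
  ... | inj₂ refl = inj₂ (inj₂ (V⁺ sub′ u∈bag))

  V-siblings : ∀ {t r s u} → IsChild r t → IsChild s t → ¬ r ≡ s →
               V r u ≡ true → V s u ≡ true → bag t u ≡ true
  V-siblings {u = u} cr cs r≢s u∈Vr u∈Vs with V⁻ u∈Vr | V⁻ u∈Vs
  ... | a , subᵃ , u∈a | b , subᵇ , u∈b
      with TPath-leaving-subtree (proj₁ cr) subᵃ (connected u a b u∈a u∈b)
  ... | inj₁ subᵇ′ = ⊥-elim (siblings-disjoint cr cs r≢s subᵇ′ subᵇ)
  ... | inj₂ u∈t   = u∈t

  V-nbhd-closed : ∀ {r t u x} → parent r ≡ t → V r u ≡ true → bag t u ≡ false →
                  adj u x ≡ true → V r x ≡ true
  V-nbhd-closed {u = u} {x} pr u∈Vr u∉t ux with V⁻ u∈Vr | cover-e u x ux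
  ... | a , sub , u∈a | e , u∈e , x∈e with TPath-leaving-subtree pr sub (connected u a e u∈a u∈e)
  ... | inj₁ subᵉ = V⁺ subᵉ x∈e
  ... | inj₂ u∈t  = contradiction (trans (sym u∈t) u∉t) λ ()

  edge-∖ₑ⇒V : ∀ t S {v u} → edge (Gt t ∖ₑ S) v u ≡ true → V t u ≡ true
  edge-∖ₑ⇒V t S {v} {u} e with adj v u | V t v | V t u | e
  ... | true  | true  | true  | _  = refl
  ... | false | _     | _     | ()
  ... | true  | false | _     | ()
  ... | true  | true  | false | ()

  edge-[]⇒ : ∀ H Y {v u} → edge (H [ Y ]) v u ≡ true → Y u ≡ true
  edge-[]⇒ H Y {v} {u} e with edge H v u | Y v | Y u | e
  ... | true  | true  | true  | _  = refl
  ... | false | _     | _     | ()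
  ... | true  | false | _     | ()
  ... | true  | true  | false | ()

  check-local : ∀ u {f g : Fin n → Color} → (∀ x → x ≡ u ⊎ adj u x ≡ true → f x ≡ g x) →
                (∀ x → x ≡ u ⊎ adj u x ≡ true → g x ∈ L x) → check u f ≡ check u g
  check-local u {f} {g} agree valid = begin
    check u f                     ≡⟨ checkN-spec u f valid-f ⟨
    checkN u (f u) (nbhd f (f u)) ≡⟨ cong (checkN u (f u)) nbhd-agree ⟩
    checkN u (f u) (nbhd g (f u)) ≡⟨ cong (λ i → checkN u i (nbhd g i)) (agree u (inj₁ refl)) ⟩
    checkN u (g u) (nbhd g (g u)) ≡⟨ checkN-spec u g valid ⟩
    check u g                     ∎
    where
    open ≡-Reasoning
    nbhd : (Fin n → Color) → (i : Color) → N u i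
    nbhd h i = bigop (plus u i) (eN u i) (adj u) (λ x → newN u i x (h x))
    valid-f : ∀ x → x ≡ u ⊎ adj u x ≡ true → f x ∈ L x
    valid-f x x∈N = subst (_∈ L x) (sym (agree x x∈N)) (valid x x∈N)
    nbhd-agree : nbhd f (f u) ≡ nbhd g (f u)
    nbhd-agree = ⊞.foldWhere-cong u (f u) (allFin n) (λ _ → refl)
                   (λ x ux → cong (newN u (f u) x) (agree x (inj₂ ux)))

  check-in-subtree : ∀ {r t u} {f g : Fin n → Color} → parent r ≡ t →
                     (∀ x → V r x ≡ true → f x ≡ g x) → ValidIn (V r) g →
                     V r u ≡ true → bag t u ≡ false → check u f ≡ check u g
  check-in-subtree {r} {u = u} pr agree valid u∈Vr u∉X =
    check-local u (λ x → agree x ∘ in-Vr) (λ x → valid x ∘ in-Vr)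
    where
    in-Vr : ∀ {x} → x ≡ u ⊎ adj u x ≡ true → V r x ≡ true
    in-Vr (inj₁ refl) = u∈Vr
    in-Vr (inj₂ ux)   = V-nbhd-closed pr u∈Vr u∉X ux

  ns-cong : ∀ v i H {f g : Fin n → Color} → (∀ u → edge H v u ≡ true → f u ≡ g u) →
            ns v i f H ≡ ns v i g H
  ns-cong v i H agree =
    ⊞.foldWhere-cong v i (allFin n) (λ _ → refl) (λ u e → cong (newN v i u) (agree u e))

  module Join (t r s : Fin m) (cr : IsChild r t) (cs : IsChild s t) (r≢s : ¬ r ≡ s)
              (children : ∀ t′ → IsChild t′ t → t′ ≡ r ⊎ t′ ≡ s)
              (bagʳ : ∀ u → bag r u ≡ bag t u) (bagˢ : ∀ u → bag s u ≡ bag t u)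
              (S : VSet) (S⊆X : ∀ u → S u ≡ true → bag t u ≡ true) where

    X : VSet
    X = bag t

    Gt′ GX Gr Gs : Subgraph
    Gt′ = Gt t ∖ₑ S
    GX  = Gt′ [ X ]
    Gr  = Gt r ∖ₑ bag r
    Gs  = Gt s ∖ₑ bag s

    X⊆Vʳ : ∀ {u} → X u ≡ true → V r u ≡ true
    X⊆Vʳ u∈X = bag⊆V (trans (bagʳ _) u∈X)

    X⊆Vˢ : ∀ {u} → X u ≡ true → V s u ≡ true
    X⊆Vˢ u∈X = bag⊆V (trans (bagˢ _) u∈X)

    position : ∀ u → Position (X u) (V r u) (V s u) (V t u)
    position u with X u in u∈X
    ... | true rewrite X⊆Vʳ u∈X | X⊆Vˢ u∈X | bag⊆V u∈X = inBag
    ... | false with V r u in u∈Vr | V s u in u∈Vs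
    ... | true  | true  = contradiction (trans (sym (V-siblings cr cs r≢s u∈Vr u∈Vs)) u∈X) λ ()
    ... | true  | false rewrite V-child (proj₁ cr) u∈Vr = onlyR
    ... | false | true  rewrite V-child (proj₁ cs) u∈Vs = onlyS
    ... | false | false with V t u in u∈Vt
    ... | false = outside
    ... | true with V-children children u∈Vt
    ... | inj₁ u∈X′         = contradiction (trans (sym u∈X′) u∈X) λ ()
    ... | inj₂ (inj₁ u∈Vr′) = contradiction (trans (sym u∈Vr′) u∈Vr) λ ()
    ... | inj₂ (inj₂ u∈Vs′) = contradiction (trans (sym u∈Vs′) u∈Vs) λ ()

    S-edge-outside : ∀ v u → X u ≡ false → not (S v ∧ S u) ≡ true
    S-edge-outside v u u∉X with S u in u∈S
    ... | false = cong not (∧-zeroʳ (S v))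
    ... | true  = contradiction (trans (sym (S⊆X u u∈S)) u∉X) λ ()

    module _ {v : Fin n} (v∈X : X v ≡ true) where

      edge-inBag : ∀ u → X u ∧ edge Gt′ v u ≡ edge GX v u
      edge-inBag u rewrite v∈X = ∧-comm (X u) _

      edge-belowʳ : ∀ u → V r u ∧ (not (X u) ∧ edge Gt′ v u) ≡ edge Gr v u
      edge-belowʳ u rewrite bag⊆V v∈X | X⊆Vʳ v∈X | bagʳ u | bagʳ v | v∈X =
        Position-edgeʳ (position u) (adj v u) _ (S-edge-outside v u)

      edge-belowˢ : ∀ u → not (V r u) ∧ (not (X u) ∧ edge Gt′ v u) ≡ edge Gs v u
      edge-belowˢ u rewrite bag⊆V v∈X | X⊆Vˢ v∈X | bagˢ u | bagˢ v | v∈X =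
        Position-edgeˢ (position u) (adj v u) _ (S-edge-outside v u)

      ns-split : ∀ i (f : Fin n → Color) →
                 ns v i f Gt′ ≡ plus v i (ns v i f GX) (plus v i (ns v i f Gr) (ns v i f Gs))
      ns-split i f =
        trans (foldWhere-split (allFin n) (edge Gt′ v) X g)
              (cong₂ (plus v i) (foldWhere-cong (allFin n) edge-inBag (λ _ _ → refl))
                (trans (foldWhere-split (allFin n) _ (V r) g)
                       (cong₂ (plus v i) (foldWhere-cong (allFin n) edge-belowʳ (λ _ _ → refl))
                                         (foldWhere-cong (allFin n) edge-belowˢ (λ _ _ → refl)))))
        where
        open ⊞ v i using (foldWhere-cong; foldWhere-split)
        g : Fin n → N v i
        g u = newN v i u (f u)

      ns-join : ∀ i (x : N v i) {c f fʳ fˢ : Fin n → Color} →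
                (∀ u → X u ≡ true → f u ≡ c u) → (∀ u → V r u ≡ true → f u ≡ fʳ u) →
                (∀ u → V s u ≡ true → f u ≡ fˢ u) →
                plus v i x (ns v i f Gt′) ≡
                plus v i (plus v i (plus v i x (ns v i c GX)) (ns v i fʳ Gr)) (ns v i fˢ Gs)
      ns-join i x {c} {f} {fʳ} {fˢ} f≗c f≗fʳ f≗fˢ = begin
        x ⊞ ns v i f Gt′                                  ≡⟨ cong (x ⊞_) (ns-split i f) ⟩
        x ⊞ (ns v i f GX ⊞ (ns v i f Gr ⊞ ns v i f Gs))
          ≡⟨ cong (x ⊞_) (cong₂ _⊞_ nsˣ (cong₂ _⊞_ nsʳ nsˢ)) ⟩
        x ⊞ (ns v i c GX ⊞ (ns v i fʳ Gr ⊞ ns v i fˢ Gs)) ≡⟨ plus-assoc v i _ _ _ ⟨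
        (x ⊞ ns v i c GX) ⊞ (ns v i fʳ Gr ⊞ ns v i fˢ Gs) ≡⟨ plus-assoc v i _ _ _ ⟨
        ((x ⊞ ns v i c GX) ⊞ ns v i fʳ Gr) ⊞ ns v i fˢ Gs ∎
        where
        open ≡-Reasoning
        _⊞_ : N v i → N v i → N v i
        _⊞_ = plus v i
        nsˣ : ns v i f GX ≡ ns v i c GX
        nsˣ = ns-cong v i GX (λ u e → f≗c u (edge-[]⇒ Gt′ X e))
        nsʳ : ns v i f Gr ≡ ns v i fʳ Gr
        nsʳ = ns-cong v i Gr (λ u e → f≗fʳ u (edge-∖ₑ⇒V r (bag r) e))
        nsˢ : ns v i f Gs ≡ ns v i fˢ Gs
        nsˢ = ns-cong v i Gs (λ u e → f≗fˢ u (edge-∖ₑ⇒V s (bag s) e))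

    wω-split : ∀ ω {f fʳ fˢ : Fin n → Color} →
               (∀ u → V r u ≡ true → f u ≡ fʳ u) → (∀ u → V s u ≡ true → f u ≡ fˢ u) →
               wω X Gt′ ω f ≡ (wsum X ω ⊕ wω (bag r) Gr ωe fʳ) ⊕ wω (bag s) Gs ωe fˢ
    wω-split ω {f} {fʳ} {fˢ} f≗fʳ f≗fˢ = begin
      W ⊕ wsum outsideX (weight f)                    ≡⟨ cong (W ⊕_) (trans split (cong₂ _⊕_ weightʳ weightˢ)) ⟩
      W ⊕ (A ⊕ B)                                     ≡⟨ ⊕-assoc W A B ⟨
      (W ⊕ A) ⊕ B                                     ≡⟨ cong₂ (λ a b → (W ⊕ a) ⊕ b) (⊕-identity A) (⊕-identity B) ⟨
      (W ⊕ (e⊕ ⊕ A)) ⊕ (e⊕ ⊕ B)                       ≡⟨ cong₂ (λ a b → (W ⊕ (a ⊕ A)) ⊕ (b ⊕ B)) ωeʳ ωeˢ ⟨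
      (W ⊕ wω (bag r) Gr ωe fʳ) ⊕ wω (bag s) Gs ωe fˢ ∎
      where
      open ≡-Reasoning
      W : Wt
      W = wsum X ω
      weight : (Fin n → Color) → Fin n → Wt
      weight h u = w u (h u)
      outsideX : VSet
      outsideX u = V t u ∧ not (X u)
      A B : Wt
      A = wsum (λ u → V r u ∧ not (bag r u)) (weight fʳ)
      B = wsum (λ u → V s u ∧ not (bag s u)) (weight fˢ)
      split : wsum outsideX (weight f) ≡
              wsum (λ u → V r u ∧ outsideX u) (weight f) ⊕ wsum (λ u → not (V r u) ∧ outsideX u) (weight f)
      split = ⊕.foldWhere-split (allFin n) outsideX (V r) (weight f)
      belowʳ : ∀ u → V r u ∧ outsideX u ≡ V r u ∧ not (bag r u)
      belowʳ u rewrite bagʳ u = Position-vertexʳ (position u)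
      belowˢ : ∀ u → not (V r u) ∧ outsideX u ≡ V s u ∧ not (bag s u)
      belowˢ u rewrite bagˢ u = Position-vertexˢ (position u)
      weightʳ : wsum (λ u → V r u ∧ outsideX u) (weight f) ≡ A
      weightʳ = ⊕.foldWhere-cong (allFin n) belowʳ (λ u e → cong (w u) (f≗fʳ u (∧-trueˡ (V r u) e)))
      weightˢ : wsum (λ u → not (V r u) ∧ outsideX u) (weight f) ≡ B
      weightˢ = ⊕.foldWhere-cong (allFin n) belowˢ (λ u e → cong (w u) (f≗fˢ u (∧-trueˡ (V s u) e)))
      ωeʳ : wsum (bag r) ωe ≡ e⊕
      ωeʳ = ⊕.foldWhere-ε (allFin n) (bag r)
      ωeˢ : wsum (bag s) ωe ≡ e⊕
      ωeˢ = ⊕.foldWhere-ε (allFin n) (bag s)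

    ChildColoring : Fin m → (c : Fin n → Color) → ((v : Fin n) → N v (c v)) → (Fin n → Color) → Set
    ChildColoring ch c ηᶜʰ = IsColoring (bag ch) (Gt ch ∖ₑ bag ch) c (ηe c) (ĉeq c ηᶜʰ)

    restrict : ∀ {ch c η ĉ f} → parent ch ≡ t → (∀ u → bag ch u ≡ bag t u) →
               IsColoring X Gt′ c η ĉ f → ChildColoring ch c (λ v → ns v (c v) f (Gt ch ∖ₑ bag ch)) f
    restrict {c = c} pch bagᶜʰ (valid , f≗c , _ , checks) =
      (λ u → valid u ∘ V-child pch) ,
      (λ v v∈X → f≗c v (trans (sym (bagᶜʰ v)) v∈X)) ,
      (λ v _ → sym (plus-id v (c v) _)) ,
      (λ u u∈V u∉X → checks u (V-child pch u∈V) (trans (sym (bagᶜʰ u)) u∉X))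

    restrict-good : ∀ {c η ĉ f} → IsColoring X Gt′ c η ĉ f →
                    Good t S c η ĉ (λ v → ns v (c v) f Gr) (λ v → ns v (c v) f Gs)
    restrict-good {c} {η} {ĉ} (_ , f≗c , holds , _) v v∈X =
      subst (Holds (ĉ v)) (ns-join v∈X (c v) (η v) f≗c (λ _ _ → refl) (λ _ _ → refl)) (holds v v∈X)

    glue : ∀ {c η ĉ ηʳ ηˢ fʳ fˢ} → Good t S c η ĉ ηʳ ηˢ →
           ChildColoring r c ηʳ fʳ → ChildColoring s c ηˢ fˢ →
           ∃[ f ] IsColoring X Gt′ c η ĉ f ×
                  (∀ ω → wω X Gt′ ω f ≡ (wsum X ω ⊕ wω (bag r) Gr ωe fʳ) ⊕ wω (bag s) Gs ωe fˢ)
    glue {c} {η} {ĉ} {ηʳ} {ηˢ} {fʳ} {fˢ} good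
         (validʳ , fʳ≗c , holdsʳ , checksʳ) (validˢ , fˢ≗c , holdsˢ , checksˢ) =
      f , (valid , f≗c , holds , checks) , (λ ω → wω-split ω f≗fʳ f≗fˢ)
      where
      -- On V(G_r) ∩ V(G_s) = X_t both child colorings agree with c, so preferring fʳ is harmless.
      f : Fin n → Color
      f u = if V r u then fʳ u else fˢ u
      f≗fʳ : ∀ u → V r u ≡ true → f u ≡ fʳ u
      f≗fʳ u u∈Vr rewrite u∈Vr = refl
      f≗fˢ : ∀ u → V s u ≡ true → f u ≡ fˢ u
      f≗fˢ u u∈Vs with V r u in u∈Vr
      ... | false = refl
      ... | true  = trans (fʳ≗c u (trans (bagʳ u) u∈X)) (sym (fˢ≗c u (trans (bagˢ u) u∈X)))
        where
        u∈X : X u ≡ true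
        u∈X = V-siblings cr cs r≢s u∈Vr u∈Vs
      f≗c : ∀ u → X u ≡ true → f u ≡ c u
      f≗c u u∈X = trans (f≗fʳ u (X⊆Vʳ u∈X)) (fʳ≗c u (trans (bagʳ u) u∈X))
      valid : ValidIn (V t) f
      valid u u∈Vt with V-children children u∈Vt
      ... | inj₁ u∈X         = subst (_∈ L u) (sym (f≗fʳ u (X⊆Vʳ u∈X))) (validʳ u (X⊆Vʳ u∈X))
      ... | inj₂ (inj₁ u∈Vr) = subst (_∈ L u) (sym (f≗fʳ u u∈Vr)) (validʳ u u∈Vr)
      ... | inj₂ (inj₂ u∈Vs) = subst (_∈ L u) (sym (f≗fˢ u u∈Vs)) (validˢ u u∈Vs)
      holds : ∀ v → X v ≡ true → Holds (ĉ v) (plus v (c v) (η v) (ns v (c v) f Gt′))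
      holds v v∈X = subst (Holds (ĉ v)) (sym (trans (ns-join v∈X (c v) (η v) f≗c f≗fʳ f≗fˢ) children-ns))
                          (good v v∈X)
        where
        _⊞_ : N v (c v) → N v (c v) → N v (c v)
        _⊞_ = plus v (c v)
        nsʳ : ns v (c v) fʳ Gr ≡ ηʳ v
        nsʳ = trans (sym (plus-id v (c v) _)) (sym (holdsʳ v (trans (bagʳ v) v∈X)))
        nsˢ : ns v (c v) fˢ Gs ≡ ηˢ v
        nsˢ = trans (sym (plus-id v (c v) _)) (sym (holdsˢ v (trans (bagˢ v) v∈X)))
        children-ns : ((η v ⊞ ns v (c v) c GX) ⊞ ns v (c v) fʳ Gr) ⊞ ns v (c v) fˢ Gs ≡
                      ((η v ⊞ ns v (c v) c GX) ⊞ ηʳ v) ⊞ ηˢ v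
        children-ns = cong₂ (λ a b → ((η v ⊞ ns v (c v) c GX) ⊞ a) ⊞ b) nsʳ nsˢ
      checks : ∀ u → V t u ≡ true → X u ≡ false → check u f ≡ true
      checks u u∈Vt u∉X with V-children children u∈Vt
      ... | inj₁ u∈X         = contradiction (trans (sym u∈X) u∉X) λ ()
      ... | inj₂ (inj₁ u∈Vr) = trans (check-in-subtree (proj₁ cr) f≗fʳ validʳ u∈Vr u∉X)
                                     (checksʳ u u∈Vr (trans (bagʳ u) u∉X))
      ... | inj₂ (inj₂ u∈Vs) = trans (check-in-subtree (proj₁ cs) f≗fˢ validˢ u∈Vs u∉X)
                                     (checksˢ u u∈Vs (trans (bagˢ u) u∉X))

    module _ (lam : LamType) (isλ : IsLambda lam) {c : Fin n → Color} {ω : Fin n → Wt}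
             {η : (v : Fin n) → N v (c v)} {ĉ : (v : Fin n) → CheckSpec v (c v)}
             (D : InD t S c ω) where

      λ-child : Fin m → ((v : Fin n) → N v (c v)) → Wt
      λ-child ch ηᶜʰ = lam ch (bag ch) c ωe (ηe c) (ĉeq c ηᶜʰ)

      child-InD : ∀ ch → (∀ u → bag ch u ≡ bag t u) → InD ch (bag ch) c ωe
      child-InD ch bagᶜʰ =
        (λ _ u∈X → u∈X) ,
        (λ u u∈X → proj₁ (proj₂ D) u (trans (sym (bagᶜʰ u)) u∈X)) ,
        (λ _ _ → inj₁ refl)

      isMin-child : ∀ ch → (∀ u → bag ch u ≡ bag t u) → ∀ ηᶜʰ →
                    IsMin (λ-child ch ηᶜʰ) (LamSet ch (bag ch) c ωe (ηe c) (ĉeq c ηᶜʰ))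
      isMin-child ch bagᶜʰ ηᶜʰ = isλ ch (bag ch) c ωe (ηe c) (ĉeq c ηᶜʰ) (child-InD ch bagᶜʰ)

      join-lower-bound : ∀ {ηʳ ηˢ} → Good t S c η ĉ ηʳ ηˢ →
                         lam t S c ω η ĉ ≼ ((wsum X ω ⊕ λ-child r ηʳ) ⊕ λ-child s ηˢ)
      join-lower-bound {ηʳ} {ηˢ} good with proj₂ (isMin-child r bagʳ ηʳ) | proj₂ (isMin-child s bagˢ ηˢ)
      ... | inj₁ λʳ≡Error | _ rewrite λʳ≡Error =
            subst (_ ≼_) (sym (trans (cong (_⊕ _) (⊕-absorbʳ _)) (⊕-absorb _))) (Error-max _)
      ... | inj₂ _ | inj₁ λˢ≡Error rewrite λˢ≡Error =
            subst (_ ≼_) (sym (⊕-absorbʳ _)) (Error-max _)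
      ... | inj₂ (fʳ , colʳ , wʳ) | inj₂ (fˢ , colˢ , wˢ) with glue good colʳ colˢ
      ... | f , col , weight =
            subst (_ ≼_) (trans (weight ω) (cong₂ (λ a b → (wsum X ω ⊕ a) ⊕ b) wʳ wˢ))
                  (proj₁ (isλ t S c ω η ĉ D) _ (f , col , refl))

      isMin-join : IsMin (lam t S c ω η ĉ) (JoinSet lam t r s S c ω η ĉ)
      isMin-join = (λ _ (_ , _ , good , x≡) → subst (_ ≼_) (sym x≡) (join-lower-bound good)) , attained
        where
        attained : lam t S c ω η ĉ ≡ Error ⊎ JoinSet lam t r s S c ω η ĉ (lam t S c ω η ĉ)
        attained with proj₂ (isλ t S c ω η ĉ D)
        ... | inj₁ λ≡Error = inj₁ λ≡Error
        ... | inj₂ (f , col , wf) = inj₂ (ηʳ , ηˢ , good , antisym (join-lower-bound good) upper)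
          where
          ηʳ ηˢ : (v : Fin n) → N v (c v)
          ηʳ v = ns v (c v) f Gr
          ηˢ v = ns v (c v) f Gs
          good : Good t S c η ĉ ηʳ ηˢ
          good = restrict-good col
          joined : Wt
          joined = (wsum X ω ⊕ λ-child r ηʳ) ⊕ λ-child s ηˢ
          upper : joined ≼ lam t S c ω η ĉ
          upper = subst (joined ≼_) (trans (sym (wω-split ω (λ _ _ → refl) (λ _ _ → refl))) wf)
                        (⊕-mono₂ (wsum X ω) restrictedʳ restrictedˢ)
            where
            restrictedʳ : λ-child r ηʳ ≼ wω (bag r) Gr ωe f
            restrictedʳ = proj₁ (isMin-child r bagʳ ηʳ) _ (f , restrict (proj₁ cr) bagʳ col , refl)
            restrictedˢ : λ-child s ηˢ ≼ wω (bag s) Gs ωe f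
            restrictedˢ = proj₁ (isMin-child s bagˢ ηˢ) _ (f , restrict (proj₁ cs) bagˢ col , refl)

lemma5p4 : ∀ {n : ℕ} (σ : Setting n) (τ : TreeDec σ) → let open Ctx σ τ in
    (lam : LamType) → IsLambda lam →
    (t r s : Fin m) → IsChild r t → IsChild s t → ¬ (r ≡ s) →
    (∀ t' → IsChild t' t → t' ≡ r ⊎ t' ≡ s) →
    (∀ u → bag r u ≡ bag t u) → (∀ u → bag s u ≡ bag t u) →
    ∀ S c ω η ĉ → InD t S c ω →
    IsMin (lam t S c ω η ĉ) (JoinSet lam t r s S c ω η ĉ)
lemma5p4 σ τ lam isλ t r s cr cs r≢s children bagʳ bagˢ S c ω η ĉ D =
  Join.isMin-join σ τ t r s cr cs r≢s children bagʳ bagˢ S (proj₁ D) lam isλ D
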